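{- Let $\Lambda$ be a normal term-modal logic, $\Gamma\subseteq\mathcal{L}$ $\Lambda$-consistent, $\Gamma^*$ as in the construction of the canonical model, $M_{(\Lambda,\Gamma^*)}=(D,W,R,I)$ the canonical model and $v$ the canonical valuation. If $w\in W$, $K_x\varphi\in w$ with $v(x)=\alpha$, and $y\in\mathtt{V}^+$ satisfies $v(y)=v(x)$, then $K_y\varphi\in w$.
   Context: Term-modal language $\mathcal{L}$ over a signature $\Sigma=(\mathtt{V},\mathtt{C},\mathtt{R},\mathtt{F},\mathtt{t})$ with variables and constants typed $\mathtt{agt}$ or $\mathtt{obj}$ (infinitely many variables of each type), typed relation symbols including $=$, typed function symbols: $\varphi::=r(t_1,\dots,t_n)\mid\neg\varphi\mid\varphi\wedge\varphi\mid K_t\varphi\mid\forall x\varphi$, $t$ of type $\mathtt{agt}$ in $K_t\varphi$. A normal term-modal logic is a set $\Lambda\subseteq\mathcal{L}$ containing all instances of: tautologies; $\forall x\varphi\to\varphi(y/x)$; $t=t$; PS $(x=y)\to(\varphi(x)\to\varphi(y))$ for variables $x,y$; $(c=c)\to\exists x(x=c)$; $x\neq y$ for variables of different types; $K_t(\varphi\to\psi)\to(K_t\varphi\to K_t\psi)$; $\forall xK_t\varphi\to K_t\forall x\varphi$ ($x$ not in $t$); $(x\neq y)\to K_t(x\neq y)$; closed under modus ponens, from $\varphi$ infer $K_t\varphi$, and from $\varphi\to\psi$ infer $\varphi\to\forall x\psi$ ($x$ not free in $\varphi$). $\Lambda$-consistency and maximal $\Lambda$-consistency are as usual. Canonical model.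 $\Sigma^+$ extends $\Sigma$ by countably infinitely many new variables of each type; $\mathtt{V}^+$, $\mathcal{L}^+$ its variables and language (consistency in $\mathcal{L}^+$ w.r.t. the logic generated by $\Lambda$). A set $\Delta\subseteq\mathcal{L}^+$ bears witnesses if for every $\varphi$ and variable $x$ some variable $y$ has $(\varphi(y/x)\to\forall x\varphi)\in\Delta$. Sets share identity theory if they contain the same formulas $x=y$ with $x,y\in\mathtt{V}^+$. $\Gamma^*\subseteq\mathcal{L}^+$ is maximal $\Lambda$-consistent, witness-bearing and contains $\Gamma$. $M_{(\Lambda,\Gamma^*)}=(D,W,R,I)$: $[z]=\{z':(z=z')\in\Gamma^*\}$; $D_{\mathtt{agt}}$ (resp. $D_{\mathtt{obj}}$) the classes $[z]$ of agent (resp. object) variables; $W$ all maximal $\Lambda$-consistent witness-bearing subsets of $\mathcal{L}^+$ sharing identity theory with $\Gamma^*$; $(w,w')\in R(\alpha)$ iff for all $K_x\varphi\in w$ with $x\in\alpha$, $\varphi\in w'$; $I(r,w)=\{([x_1],\dots,[x_n]):r(x_1,\dots,x_n)\in w\}$, $I(f,w)=\{([x_1],\dots,[x_n]):(f(x_1,\dots,x_{n-1})=x_n)\in w\}$, $I(c,w)=[x]$ where $(c=x)\in w$. The canonical valuation is $v(x)=[x]$. -}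

module Defs where

open import Data.Nat using (ℕ)
open import Data.Bool using (Bool; true; false; _∧_; _∨_; not; if_then_else_)
open import Data.List using (List; []; _∷_)
open import Data.List.Relation.Unary.All using (All)
open import Data.Product using (Σ; ∃; _×_; _,_)
open import Data.Sum using (_⊎_)
open import Relation.Binary.PropositionalEquality using (_≡_)
open import Relation.Nullary using (¬_)
open import Function.Bundles using (_⇔_)

data Ty : Set where
  agt obj : Ty

_==T_ : Ty → Ty → Bool
agt ==T agt = true
obj ==T obj = true
_   ==T _   = false

_==N_ : ℕ → ℕ → Bool
ℕ.zero ==N ℕ.zero = true
ℕ.suc m ==N ℕ.suc n = m ==N n
_ ==N _ = false

_==B_ : Bool → Bool → Bool
true ==B true = true
false ==B false = true
_ ==B _ = false

-- A variable of type τ is  var n b : the n-th variable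
-- of type τ; b = false: an original variable of Σ (set V),
-- b = true: one of the countably many new variables added in Σ⁺.

data Var (τ : Ty) : Set where
  var : ℕ → Bool → Var τ

isNew : ∀ {τ} → Var τ → Bool
isNew (var _ b) = b

eqV : ∀ {τ σ} → Var τ → Var σ → Bool
eqV {τ} {σ} (var m b) (var n c) = (τ ==T σ) ∧ ((m ==N n) ∧ (b ==B c))

castV : ∀ {τ σ} → Var τ → Var σ
castV (var n b) = var n b

rn : ∀ {τ σ} → Var τ → Var τ → Var σ → Var σ
rn x y z = if eqV x z then castV y else z

-- Signatures  Σ = (V, C, R, F, t)   (variables fixed above; = is built in)

record Signature : Set₁ where
  field
    Con   : Set
    conTy : Con → Ty
    Rel   : Set
    relAr : Rel → List Ty
    Fun   : Set
    funAr : Fun → List Ty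
    funTy : Fun → Ty

module TML (S : Signature) where
  open Signature S

  mutual
    data Term : Ty → Set where
      v   : ∀ {τ} → Var τ → Term τ
      c   : (k : Con) → Term (conTy k)
      app : (f : Fun) → Args (funAr f) → Term (funTy f)

    data Args : List Ty → Set where
      []  : Args []
      _∷_ : ∀ {τ τs} → Term τ → Args τs → Args (τ ∷ τs)

  infix 8 _≐_
  data Formula : Set where
    rel : (r : Rel) → Args (relAr r) → Formula
    _≐_ : ∀ {τ σ} → Term τ → Term σ → Formula
    ¬'  : Formula → Formula
    _∧'_ : Formula → Formula → Formula
    K   : Term agt → Formula → Formula
    ∀'  : ∀ {τ} → Var τ → Formula → Formula

  infixr 5 _⇒_
  _⇒_ : Formula → Formula → Formula
  φ ⇒ ψ = ¬' (φ ∧' ¬' ψ)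

  ∃' : ∀ {τ} → Var τ → Formula → Formula
  ∃' x φ = ¬' (∀' x (¬' φ))

  _≠_ : ∀ {τ σ} → Term τ → Term σ → Formula
  s ≠ t = ¬' (s ≐ t)

  mutual
    occT : ∀ {τ σ} → Var τ → Term σ → Bool
    occT x (v y)     = eqV x y
    occT x (c k)     = false
    occT x (app f a) = occA x a

    occA : ∀ {τ τs} → Var τ → Args τs → Bool
    occA x []      = false
    occA x (t ∷ a) = occT x t ∨ occA x a

  free : ∀ {τ} → Var τ → Formula → Bool
  free x (rel r a) = occA x a
  free x (s ≐ t)   = occT x s ∨ occT x t
  free x (¬' φ)    = free x φ
  free x (φ ∧' ψ)  = free x φ ∨ free x ψ
  free x (K t φ)   = occT x t ∨ free x φ
  free x (∀' z φ)  = not (eqV z x) ∧ free x φ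

  mutual
    origT : ∀ {σ} → Term σ → Bool
    origT (v y)     = not (isNew y)
    origT (c k)     = true
    origT (app f a) = origA a

    origA : ∀ {τs} → Args τs → Bool
    origA []      = true
    origA (t ∷ a) = origT t ∧ origA a

  origF : Formula → Bool
  origF (rel r a) = origA a
  origF (s ≐ t)   = origT s ∧ origT t
  origF (¬' φ)    = origF φ
  origF (φ ∧' ψ)  = origF φ ∧ origF ψ
  origF (K t φ)   = origT t ∧ origF φ
  origF (∀' z φ)  = not (isNew z) ∧ origF φ

  -- membership in the language L (as opposed to L⁺)
  InL : Formula → Set
  InL φ = origF φ ≡ true

  InLT : ∀ {σ} → Term σ → Set
  InLT t = origT t ≡ true

  mutual
    subT : ∀ {τ σ} → Var τ → Var τ → Term σ → Term σ
    subT x y (v z)     = v (rn x y z)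
    subT x y (c k)     = c k
    subT x y (app f a) = app f (subA x y a)

    subA : ∀ {τ τs} → Var τ → Var τ → Args τs → Args τs
    subA x y []      = []
    subA x y (t ∷ a) = subT x y t ∷ subA x y a

  sub : ∀ {τ} → Var τ → Var τ → Formula → Formula
  sub x y (rel r a) = rel r (subA x y a)
  sub x y (s ≐ t)   = subT x y s ≐ subT x y t
  sub x y (¬' φ)    = ¬' (sub x y φ)
  sub x y (φ ∧' ψ)  = sub x y φ ∧' sub x y ψ
  sub x y (K t φ)   = K (subT x y t) (sub x y φ)
  sub x y (∀' z φ)  = if eqV z x then ∀' z φ else ∀' z (sub x y φ)

  freeFor : ∀ {τ} → Var τ → Var τ → Formula → Bool
  freeFor y x (rel r a) = true
  freeFor y x (s ≐ t)   = true
  freeFor y x (¬' φ)    = freeFor y x φ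
  freeFor y x (φ ∧' ψ)  = freeFor y x φ ∧ freeFor y x ψ
  freeFor y x (K t φ)   = freeFor y x φ
  freeFor y x (∀' z φ)  = not (free x (∀' z φ)) ∨ (not (eqV z y) ∧ freeFor y x φ)

  data PForm : Set where
    atom : ℕ → PForm
    pneg : PForm → PForm
    pand : PForm → PForm → PForm

  evalP : (ℕ → Bool) → PForm → Bool
  evalP ρ (atom n)   = ρ n
  evalP ρ (pneg p)   = not (evalP ρ p)
  evalP ρ (pand p q) = evalP ρ p ∧ evalP ρ q

  Tautology : PForm → Set
  Tautology p = ∀ ρ → evalP ρ p ≡ true

  instP : (ℕ → Formula) → PForm → Formula
  instP σ (atom n)   = σ n
  instP σ (pneg p)   = ¬' (instP σ p)
  instP σ (pand p q) = instP σ p ∧' instP σ q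

  data Axiom : Formula → Set where
    taut  : ∀ p σ → Tautology p → Axiom (instP σ p)
    inst  : ∀ {τ} (x y : Var τ) φ → freeFor y x φ ≡ true →
            Axiom (∀' x φ ⇒ sub x y φ)
    refl= : ∀ {τ} (t : Term τ) → Axiom (t ≐ t)
    PS    : ∀ {τ} (x y : Var τ) φ → freeFor y x φ ≡ true →
            Axiom (v x ≐ v y ⇒ (φ ⇒ sub x y φ))
    cnst  : (k : Con) (x : Var (conTy k)) →
            Axiom (c k ≐ c k ⇒ ∃' x (v x ≐ c k))
    difTy : (x : Var agt) (y : Var obj) → Axiom (v x ≠ v y)
    difTy' : (x : Var obj) (y : Var agt) → Axiom (v x ≠ v y)
    Kax   : ∀ t φ ψ → Axiom (K t (φ ⇒ ψ) ⇒ (K t φ ⇒ K t ψ))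
    BF    : ∀ {τ} (x : Var τ) t φ → occT x t ≡ false →
            Axiom (∀' x (K t φ) ⇒ K t (∀' x φ))
    NI    : ∀ {τ σ} (x : Var τ) (y : Var σ) t →
            Axiom (v x ≠ v y ⇒ K t (v x ≠ v y))

  Pred : Set → Set₁
  Pred A = A → Set

  record IsNormal (Λ : Pred Formula) : Set where
    field
      inL   : ∀ φ → Λ φ → InL φ
      axiom : ∀ φ → Axiom φ → InL φ → Λ φ
      mp    : ∀ φ ψ → Λ (φ ⇒ ψ) → Λ φ → Λ ψ
      nec   : ∀ t φ → InLT t → Λ φ → Λ (K t φ)
      gen   : ∀ {τ} (x : Var τ) φ ψ → free x φ ≡ false → isNew x ≡ false →
              Λ (φ ⇒ ψ) → Λ (φ ⇒ ∀' x ψ)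

  data Gen⁺ (Λ : Pred Formula) : Formula → Set where
    base : ∀ {φ} → Λ φ → Gen⁺ Λ φ
    ax   : ∀ {φ} → Axiom φ → Gen⁺ Λ φ
    mp   : ∀ {φ ψ} → Gen⁺ Λ (φ ⇒ ψ) → Gen⁺ Λ φ → Gen⁺ Λ ψ
    nec  : ∀ {φ} t → Gen⁺ Λ φ → Gen⁺ Λ (K t φ)
    gen  : ∀ {τ} (x : Var τ) {φ ψ} → free x φ ≡ false →
           Gen⁺ Λ (φ ⇒ ψ) → Gen⁺ Λ (φ ⇒ ∀' x ψ)

  imps : List Formula → Formula → Formula
  imps []       ψ = ψ
  imps (φ ∷ φs) ψ = φ ⇒ imps φs ψ

  Consistent : Pred Formula → Pred Formula → Set
  Consistent Th Δ =
    ¬ (Σ (List Formula) λ φs → All Δ φs × Σ Formula λ ψ → Th (imps φs (ψ ∧' ¬' ψ)))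

  _∪｛_｝ : Pred Formula → Formula → Pred Formula
  (Δ ∪｛ φ ｝) ψ = Δ ψ ⊎ (ψ ≡ φ)

  MaxCons⁺ : Pred Formula → Pred Formula → Set
  MaxCons⁺ Λ Δ = Consistent (Gen⁺ Λ) Δ × (∀ φ → Consistent (Gen⁺ Λ) (Δ ∪｛ φ ｝) → Δ φ)

  BearsWitnesses : Pred Formula → Set
  BearsWitnesses Δ = ∀ φ {τ} (x : Var τ) → Σ (Var τ) λ y → Δ (sub x y φ ⇒ ∀' x φ)

  ShareIdentity : Pred Formula → Pred Formula → Set
  ShareIdentity Δ Δ' = ∀ {τ σ} (x : Var τ) (y : Var σ) → (Δ (v x ≐ v y) ⇔ Δ' (v x ≐ v y))

  record IsGammaStar (Λ Γ Γ* : Pred Formula) : Set where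
    field
      maxCons   : MaxCons⁺ Λ Γ*
      witnesses : BearsWitnesses Γ*
      extends   : ∀ φ → Γ φ → Γ* φ

  World : (Λ Γ* : Pred Formula) → Pred Formula → Set
  World Λ Γ* w = MaxCons⁺ Λ w × BearsWitnesses w × ShareIdentity w Γ*

  valuation : (Γ* : Pred Formula) → ∀ {τ} → Var τ → ∀ {σ} → Pred (Var σ)
  valuation Γ* x z = Γ* (v x ≐ v z)

  -- equality of classes (extensional equality of the sets [x], [y])
  SameClass : (Γ* : Pred Formula) → ∀ {τ τ'} → Var τ → Var τ' → Set
  SameClass Γ* x y = ∀ {σ} (z : Var σ) → (valuation Γ* x z ⇔ valuation Γ* y z)

-- The only nontrivial step is the theorem  x = y → (K_x φ → K_y φ)  of the
-- logic.  Substitutivity PS cannot give it directly, since substituting y for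
-- x in K_x φ also rewrites φ.  Instead apply PS to K_u φ for a fresh agent
-- variable u, generalise over u and instantiate u by x.  In the canonical
-- model, v(y) = v(x) puts x = y into Γ*, hence into w (w shares the identity
-- theory of Γ*), and w is closed under theorems and modus ponens.
module Submission where

open import Defs
open import Data.Nat using (ℕ; zero; suc; _<_; _⊔_; s≤s)
open import Data.Nat.Properties using (m⊔n<o⇒m<o; m⊔n<o⇒n<o; n<1+n)
open import Data.Bool using (true; false)
open import Data.Bool.Properties using (∧-zeroʳ; ∨-conicalˡ; ∨-conicalʳ)
open import Data.List using (List; []; _∷_; _++_)
open import Data.List.Relation.Unary.All using (All; []; _∷_)
open import Data.List.Relation.Unary.All.Properties using (++⁺)
open import Data.Product using (Σ; _×_; _,_; proj₁; proj₂)
open import Data.Sum using (inj₁; inj₂)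
open import Relation.Binary.PropositionalEquality
  using (_≡_; refl; sym; cong; cong₂; subst)
open import Function.Bundles using (Equivalence)

==T-refl : ∀ τ → (τ ==T τ) ≡ true
==T-refl agt = refl
==T-refl obj = refl

==N-refl : ∀ n → (n ==N n) ≡ true
==N-refl zero    = refl
==N-refl (suc n) = ==N-refl n

>⇒==N-false : ∀ {m n} → m < n → (n ==N m) ≡ false
>⇒==N-false {zero}  {suc n} _       = refl
>⇒==N-false {suc m} {suc n} (s≤s p) = >⇒==N-false p

==B-refl : ∀ b → (b ==B b) ≡ true
==B-refl true  = refl
==B-refl false = refl

index : ∀ {τ} → Var τ → ℕ
index (var n _) = n

eqV-refl : ∀ {τ} (x : Var τ) → eqV x x ≡ true
eqV-refl {τ} (var n b) rewrite ==T-refl τ | ==N-refl n | ==B-refl b = refl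

>⇒eqV-false : ∀ {τ σ} (x : Var τ) (z : Var σ) → index z < index x → eqV x z ≡ false
>⇒eqV-false {τ} {σ} (var n b) (var m c) p rewrite >⇒==N-false p = ∧-zeroʳ (τ ==T σ)

castV-id : ∀ {τ} (x : Var τ) → castV x ≡ x
castV-id (var n b) = refl

rn-self : ∀ {τ} (u z : Var τ) → rn u z u ≡ z
rn-self u z rewrite eqV-refl u = castV-id z

rn-other : ∀ {τ σ} (u z : Var τ) (y : Var σ) → eqV u y ≡ false → rn u z y ≡ y
rn-other u z y u≢y rewrite u≢y = refl

module Syntax (S : Signature) where
  open TML S

  mutual
    maxIndexT : ∀ {σ} → Term σ → ℕ
    maxIndexT (v z)     = index z
    maxIndexT (c k)     = 0
    maxIndexT (app f a) = maxIndexA a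

    maxIndexA : ∀ {τs} → Args τs → ℕ
    maxIndexA []      = 0
    maxIndexA (t ∷ a) = maxIndexT t ⊔ maxIndexA a

  maxIndex : Formula → ℕ
  maxIndex (rel r a) = maxIndexA a
  maxIndex (s ≐ t)   = maxIndexT s ⊔ maxIndexT t
  maxIndex (¬' φ)    = maxIndex φ
  maxIndex (φ ∧' ψ)  = maxIndex φ ⊔ maxIndex ψ
  maxIndex (K t φ)   = maxIndexT t ⊔ maxIndex φ
  maxIndex (∀' z φ)  = maxIndex φ

  mutual
    occT-fresh : ∀ {τ σ} (u : Var τ) (t : Term σ) → maxIndexT t < index u → occT u t ≡ false
    occT-fresh u (v z)     p = >⇒eqV-false u z p
    occT-fresh u (c k)     p = refl
    occT-fresh u (app f a) p = occA-fresh u a p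

    occA-fresh : ∀ {τ τs} (u : Var τ) (a : Args τs) → maxIndexA a < index u → occA u a ≡ false
    occA-fresh u []      p = refl
    occA-fresh u (t ∷ a) p
      rewrite occT-fresh u t (m⊔n<o⇒m<o (maxIndexT t) _ p) = occA-fresh u a (m⊔n<o⇒n<o _ (maxIndexA a) p)

  free-fresh : ∀ {τ} (u : Var τ) φ → maxIndex φ < index u → free u φ ≡ false
  free-fresh u (rel r a) p = occA-fresh u a p
  free-fresh u (s ≐ t) p
    rewrite occT-fresh u s (m⊔n<o⇒m<o (maxIndexT s) _ p) = occT-fresh u t (m⊔n<o⇒n<o _ (maxIndexT t) p)
  free-fresh u (¬' φ) p = free-fresh u φ p
  free-fresh u (φ ∧' ψ) p
    rewrite free-fresh u φ (m⊔n<o⇒m<o (maxIndex φ) _ p) = free-fresh u ψ (m⊔n<o⇒n<o _ (maxIndex ψ) p)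
  free-fresh u (K t φ) p
    rewrite occT-fresh u t (m⊔n<o⇒m<o (maxIndexT t) _ p) = free-fresh u φ (m⊔n<o⇒n<o _ (maxIndex φ) p)
  free-fresh u (∀' z φ) p rewrite free-fresh u φ p = ∧-zeroʳ _

  freshVar : ∀ τ φ → Σ (Var τ) λ u → free u φ ≡ false
  freshVar τ φ = var (suc (maxIndex φ)) true , free-fresh _ φ (n<1+n (maxIndex φ))

  mutual
    subT-nonOcc : ∀ {τ σ} (u z : Var τ) (t : Term σ) → occT u t ≡ false → subT u z t ≡ t
    subT-nonOcc u z (v y)     h = cong v (rn-other u z y h)
    subT-nonOcc u z (c k)     h = refl
    subT-nonOcc u z (app f a) h = cong (app f) (subA-nonOcc u z a h)

    subA-nonOcc : ∀ {τ τs} (u z : Var τ) (a : Args τs) → occA u a ≡ false → subA u z a ≡ a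
    subA-nonOcc u z []      h = refl
    subA-nonOcc u z (t ∷ a) h =
      cong₂ _∷_ (subT-nonOcc u z t (∨-conicalˡ _ _ h)) (subA-nonOcc u z a (∨-conicalʳ _ _ h))

  sub-nonFree : ∀ {τ} (u z : Var τ) φ → free u φ ≡ false → sub u z φ ≡ φ
  sub-nonFree u z (rel r a) h = cong (rel r) (subA-nonOcc u z a h)
  sub-nonFree u z (s ≐ t) h =
    cong₂ _≐_ (subT-nonOcc u z s (∨-conicalˡ _ _ h)) (subT-nonOcc u z t (∨-conicalʳ _ _ h))
  sub-nonFree u z (¬' φ) h = cong ¬' (sub-nonFree u z φ h)
  sub-nonFree u z (φ ∧' ψ) h =
    cong₂ _∧'_ (sub-nonFree u z φ (∨-conicalˡ _ _ h)) (sub-nonFree u z ψ (∨-conicalʳ _ _ h))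
  sub-nonFree u z (K t φ) h =
    cong₂ K (subT-nonOcc u z t (∨-conicalˡ _ _ h)) (sub-nonFree u z φ (∨-conicalʳ _ _ h))
  sub-nonFree u z (∀' y φ) h with eqV y u
  ... | true  = refl
  ... | false = cong (∀' y) (sub-nonFree u z φ h)

  freeFor-nonFree : ∀ {τ} (z u : Var τ) φ → free u φ ≡ false → freeFor z u φ ≡ true
  freeFor-nonFree z u (rel r a) h = refl
  freeFor-nonFree z u (s ≐ t)   h = refl
  freeFor-nonFree z u (¬' φ)    h = freeFor-nonFree z u φ h
  freeFor-nonFree z u (φ ∧' ψ)  h
    rewrite freeFor-nonFree z u φ (∨-conicalˡ _ _ h) = freeFor-nonFree z u ψ (∨-conicalʳ _ _ h)
  freeFor-nonFree z u (K t φ)   h = freeFor-nonFree z u φ (∨-conicalʳ _ _ h)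
  freeFor-nonFree z u (∀' y φ)  h rewrite h = refl

module Derivations (S : Signature) (Λ : TML.Pred S (TML.Formula S)) where
  open TML S
  open Syntax S

  infix 3 ⊢_
  ⊢_ : Formula → Set
  ⊢_ = Gen⁺ Λ

  infixr 5 _⇒ₚ_
  _⇒ₚ_ : PForm → PForm → PForm
  p ⇒ₚ q = pneg (pand p (pneg q))

  P Q R : PForm
  P = atom 0
  Q = atom 1
  R = atom 2

  [_,_,_] : Formula → Formula → Formula → ℕ → Formula
  [ A , B , C ] 0 = A
  [ A , B , C ] 1 = B
  [ A , B , C ] _ = C

  identity-taut : Tautology (P ⇒ₚ P)
  identity-taut ρ with ρ 0
  ... | true  = refl
  ... | false = refl

  weakening-taut : Tautology (P ⇒ₚ Q ⇒ₚ P)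
  weakening-taut ρ with ρ 0 | ρ 1
  ... | true  | true  = refl
  ... | true  | false = refl
  ... | false | _     = refl

  assertion-taut : Tautology (P ⇒ₚ (P ⇒ₚ Q) ⇒ₚ Q)
  assertion-taut ρ with ρ 0 | ρ 1
  ... | true  | true  = refl
  ... | true  | false = refl
  ... | false | true  = refl
  ... | false | false = refl

  prefixing-taut : Tautology ((P ⇒ₚ Q) ⇒ₚ (R ⇒ₚ P) ⇒ₚ (R ⇒ₚ Q))
  prefixing-taut ρ with ρ 0 | ρ 1 | ρ 2
  ... | true  | true  | true  = refl
  ... | true  | true  | false = refl
  ... | true  | false | true  = refl
  ... | true  | false | false = refl
  ... | false | true  | true  = refl
  ... | false | true  | false = refl
  ... | false | false | true  = refl
  ... | false | false | false = refl

  ⊢-identity : ∀ A → ⊢ A ⇒ A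
  ⊢-identity A = ax (taut (P ⇒ₚ P) [ A , A , A ] identity-taut)

  ⊢-weaken : ∀ {B} A → ⊢ B → ⊢ A ⇒ B
  ⊢-weaken {B} A ⊢B = mp (ax (taut (P ⇒ₚ Q ⇒ₚ P) [ B , A , A ] weakening-taut)) ⊢B

  ⊢-assertion : ∀ {A} C → ⊢ A → ⊢ (A ⇒ C) ⇒ C
  ⊢-assertion {A} C ⊢A = mp (ax (taut (P ⇒ₚ (P ⇒ₚ Q) ⇒ₚ Q) [ A , C , C ] assertion-taut)) ⊢A

  ⊢-prefix-axiom : ∀ A B C → ⊢ (B ⇒ C) ⇒ (A ⇒ B) ⇒ (A ⇒ C)
  ⊢-prefix-axiom A B C = ax (taut ((P ⇒ₚ Q) ⇒ₚ (R ⇒ₚ P) ⇒ₚ (R ⇒ₚ Q)) [ B , C , A ] prefixing-taut)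

  ⊢-prefix : ∀ {B C} A → ⊢ B ⇒ C → ⊢ (A ⇒ B) ⇒ (A ⇒ C)
  ⊢-prefix A = mp (⊢-prefix-axiom A _ _)

  ⊢-trans : ∀ {A B C} → ⊢ A ⇒ B → ⊢ B ⇒ C → ⊢ A ⇒ C
  ⊢-trans ⊢A⇒B ⊢B⇒C = mp (⊢-prefix _ ⊢B⇒C) ⊢A⇒B

  -- gen needs an antecedent in which u is not free: a closed tautology will do.
  ⊢-generalise : ∀ {τ} (u : Var τ) {χ} → ⊢ χ → ⊢ ∀' u χ
  ⊢-generalise u {χ} ⊢χ = mp (gen u u-notFree (⊢-weaken θ ⊢χ)) (⊢-identity (∀' u χ))
    where
    θ : Formula
    θ = ∀' u χ ⇒ ∀' u χ
    u-notFree : free u θ ≡ false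
    u-notFree rewrite eqV-refl u = refl

  ⊢-instantiate : ∀ {τ} (u z : Var τ) {χ} → freeFor z u χ ≡ true → ⊢ ∀' u χ → ⊢ sub u z χ
  ⊢-instantiate u z z-freeFor = mp (ax (inst u z _ z-freeFor))

  ⊢-K-subject : (x y : Var agt) (φ : Formula) → ⊢ v x ≐ v y ⇒ (K (v x) φ ⇒ K (v y) φ)
  ⊢-K-subject x y φ = subst ⊢_ (sub-χ x) (⊢-instantiate u x u-freeFor (⊢-generalise u ⊢χu))
    where
    fresh : Σ (Var agt) λ u → free u (K (v y) φ) ≡ false
    fresh = freshVar agt (K (v y) φ)
    u : Var agt
    u = proj₁ fresh
    u≢y : eqV u y ≡ false
    u≢y = ∨-conicalˡ _ _ (proj₂ fresh)
    u∉φ : free u φ ≡ false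
    u∉φ = ∨-conicalʳ _ _ (proj₂ fresh)

    χ : Var agt → Formula
    χ z = v z ≐ v y ⇒ (K (v z) φ ⇒ K (v y) φ)

    sub-Ku : ∀ z → sub u z (K (v u) φ) ≡ K (v z) φ
    sub-Ku z = cong₂ K (cong v (rn-self u z)) (sub-nonFree u z φ u∉φ)

    sub-χ : ∀ z → sub u z (χ u) ≡ χ z
    sub-χ z rewrite rn-self u z | rn-other u z y u≢y | sub-nonFree u z φ u∉φ = refl

    u-freeFor : freeFor x u (χ u) ≡ true
    u-freeFor rewrite freeFor-nonFree x u φ u∉φ = refl

    ⊢χu : ⊢ χ u
    ⊢χu = subst (λ F → ⊢ v u ≐ v y ⇒ (K (v u) φ ⇒ F)) (sub-Ku y)
            (ax (PS u y (K (v u) φ) (freeFor-nonFree y u φ u∉φ)))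

  imps-++ : ∀ ps qs χ → imps (ps ++ qs) χ ≡ imps ps (imps qs χ)
  imps-++ []       qs χ = refl
  imps-++ (p ∷ ps) qs χ = cong (p ⇒_) (imps-++ ps qs χ)

  module MaximalConsistent {w : Pred Formula} (w-max : MaxCons⁺ Λ w) where

    -- If w ∪ {φ} were inconsistent, replacing every hypothesis φ of the
    -- refutation by ps would refute w itself.
    ∈-closed : ∀ {φ} ps → All w ps → (∀ C → ⊢ (φ ⇒ C) ⇒ imps ps C) → w φ
    ∈-closed {φ} ps ps∈w ⊢φ⇒C⇒ps = proj₂ w-max φ λ { (ψs , ψs∈ , ψ , ⊢ψs⇒⊥) →
      let (ψs' , ψs'∈w , ⊢ψs⇒ψs') = discharge ψs ψs∈ in
      proj₁ w-max (ψs' , ψs'∈w , ψ , mp (⊢ψs⇒ψs' _) ⊢ψs⇒⊥) }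
      where
      discharge : ∀ ψs → All (w ∪｛ φ ｝) ψs →
                  Σ (List Formula) λ ψs' → All w ψs' × (∀ χ → ⊢ imps ψs χ ⇒ imps ψs' χ)
      discharge [] [] = [] , [] , ⊢-identity
      discharge (ψ ∷ ψs) (inj₁ ψ∈w ∷ rest) =
        let (ψs' , ψs'∈w , ⊢ψs⇒ψs') = discharge ψs rest in
        ψ ∷ ψs' , ψ∈w ∷ ψs'∈w , λ χ → ⊢-prefix ψ (⊢ψs⇒ψs' χ)
      discharge (ψ ∷ ψs) (inj₂ refl ∷ rest) =
        let (ψs' , ψs'∈w , ⊢ψs⇒ψs') = discharge ψs rest in
        ps ++ ψs' , ++⁺ ps∈w ψs'∈w , λ χ →
          ⊢-trans (⊢-prefix φ (⊢ψs⇒ψs' χ))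
                  (subst (λ F → ⊢ (φ ⇒ imps ψs' χ) ⇒ F) (sym (imps-++ ps ψs' χ))
                         (⊢φ⇒C⇒ps (imps ψs' χ)))

    theorem∈ : ∀ {φ} → ⊢ φ → w φ
    theorem∈ ⊢φ = ∈-closed [] [] (λ C → ⊢-assertion C ⊢φ)

    mp∈ : ∀ {A B} → w (A ⇒ B) → w A → w B
    mp∈ {A} {B} A⇒B∈w A∈w = ∈-closed ((A ⇒ B) ∷ A ∷ []) (A⇒B∈w ∷ A∈w ∷ []) (⊢-prefix-axiom A B)

mainTheorem7 : (S : Signature) → let open TML S in
    (Λ Γ Γ* : Pred Formula) →
    IsNormal Λ →
    (∀ φ → Γ φ → InL φ) →
    Consistent Λ Γ →
    IsGammaStar Λ Γ Γ* →
    (w : Pred Formula) → World Λ Γ* w →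
    (x y : Var agt) (φ : Formula) →
    w (K (v x) φ) →
    SameClass Γ* y x →
    w (K (v y) φ)
mainTheorem7 S Λ Γ Γ* _ _ _ Γ*-gs w (w-max , _ , w-shares) x y φ Kxφ∈w y~x =
  w.mp∈ (w.mp∈ (w.theorem∈ (⊢-K-subject x y φ)) x≐y∈w) Kxφ∈w
  where
  open TML S
  open Derivations S Λ
  module Γ* = MaximalConsistent (IsGammaStar.maxCons Γ*-gs)
  module w  = MaximalConsistent w-max

  x≐y∈Γ* : Γ* (v x ≐ v y)
  x≐y∈Γ* = Equivalence.to (y~x y) (Γ*.theorem∈ (ax (refl= (v y))))

  x≐y∈w : w (v x ≐ v y)
  x≐y∈w = Equivalence.from (w-shares x y) x≐y∈Γ*
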